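{- Let $\mathcal{A}$ be a generic arrangement of $n$ hyperplanes in $\mathbb{R}^k$, $k<n$, and let $X\in\mathcal{L}(\mathcal{B}(n,k,\mathcal{A}))$ with canonical presentation $\{S_1,\dots,S_m\}$ such that $|\bigcup_{i=1}^mS_i|=n$. Then $a_X\ge m$ and $a_X\ge n\ell_X-mk$.
   Context: A central arrangement $\mathcal{A}=\{H_1,\dots,H_n\}$ in $\mathbb{R}^k$ ($k<n$), with normals $\alpha_i$, is generic if any $m\le k$ of its hyperplanes intersect in codimension $m$. Identify $\mathbb{R}^n$ with the space of parallel translates via $t\mapsto(H_i+t_i\alpha_i)_i$. For $L\subset[n]$, $|L|=k+1$, $D_L=\{t\mid\bigcap_{i\in L}(H_i+t_i\alpha_i)\ne\emptyset\}$; $\mathcal{B}(n,k,\mathcal{A})=\{D_L\}$ is the discriminantal arrangement with intersection poset $\mathcal{L}(\mathcal{B}(n,k,\mathcal{A}))$. For $|S|\ge k+1$, $D_S=\bigcap_{L\subset S,|L|=k+1}D_L$. $D_S$ is a component of $X$ if $X\subset D_S$ and $X\not\subset D_{S\cup\{j\}}$ for all $j\notin S$; the canonical presentation $\{S_1,\dots,S_m\}$ of $X$ is the set of index sets of all its components (each $|S_i|\ge k+1$). Athanasiadis rank $a_X=\sum_i(|S_i|-k)$. $\ell_X=\min_{j\in\bigcup_iS_i}|\{i\in[m]\mid j\in S_i\}|$. -}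

module Defs where

open import Level using (0ℓ)
open import Data.Nat as ℕ using (ℕ; zero; suc; _∸_; _⊓_)
open import Data.Fin using (Fin)
import Data.Fin
open import Data.Bool using (Bool; true; false)
open import Data.List using (List; []; _∷_; length; map; filter; allFin)
import Data.List.Membership.Propositional as LM
open import Data.List.Relation.Unary.All using (All)
open import Data.List.Relation.Unary.Unique.Propositional using (Unique)
open import Data.Fin.Subset as Sub using (Subset; ⁅_⁆; _∪_; ⋃; ∣_∣; _∉_)
open import Data.Fin.Subset.Properties using (_∈?_)
open import Data.Product using (Σ; ∃; _×_; _,_)
open import Relation.Nullary using (¬_)
open import Relation.Binary.PropositionalEquality using (_≡_)
open import Relation.Binary.Structures using (IsTotalOrder)
open import Algebra.Structures using (IsCommutativeRing)
open import Function.Bundles using (_⇔_)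

-- Axioms of the real numbers: a complete ordered field
-- (ℝ is, up to isomorphism, the unique model).

record Reals : Set₁ where
  infixl 6 _+_
  infixl 7 _*_
  field
    Carrier : Set
    0# 1#   : Carrier
    _+_ _*_ : Carrier → Carrier → Carrier
    -_      : Carrier → Carrier
    _≤_     : Carrier → Carrier → Set
    isCommutativeRing : IsCommutativeRing _≡_ _+_ _*_ -_ 0# 1#
    0≢1     : ¬ (0# ≡ 1#)
    inverse : ∀ x → ¬ (x ≡ 0#) → ∃ λ y → x * y ≡ 1#
    isTotalOrder : IsTotalOrder _≡_ _≤_
    +-mono-≤ : ∀ x y z → x ≤ y → (x + z) ≤ (y + z)
    *-nonneg : ∀ x y → 0# ≤ x → 0# ≤ y → 0# ≤ (x * y)
    complete : (P : Carrier → Set) → (∃ P) → (∃ λ b → ∀ x → P x → x ≤ b) →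
               ∃ λ s → (∀ x → P x → x ≤ s) × (∀ b → (∀ x → P x → x ≤ b) → s ≤ b)

-- minimum of a list of naturals (convention: 0 for the empty list)
minList : List ℕ → ℕ
minList []           = 0
minList (x ∷ [])     = x
minList (x ∷ y ∷ xs) = x ⊓ minList (y ∷ xs)

sumList : List ℕ → ℕ
sumList []       = 0
sumList (x ∷ xs) = x ℕ.+ sumList xs

module _ {n : ℕ} where

  multiplicity : List (Subset n) → Fin n → ℕ
  multiplicity Ss j = length (filter (j ∈?_) Ss)

  ℓ-of : List (Subset n) → ℕ
  ℓ-of Ss = minList (map (multiplicity Ss) (filter (_∈? ⋃ Ss) (allFin n)))

  athanasiadis : ℕ → List (Subset n) → ℕ
  athanasiadis k Ss = sumList (map (λ S → ∣ S ∣ ∸ k) Ss)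

module Geometry (R : Reals) where
  open Reals R

  Σ[_] : ∀ {k} → (Fin k → Carrier) → Carrier
  Σ[_] {zero}  f = 0#
  Σ[_] {suc k} f = f Data.Fin.zero + Σ[_] (λ i → f (Data.Fin.suc i))

  _·_ : ∀ {k} → (Fin k → Carrier) → (Fin k → Carrier) → Carrier
  u · v = Σ[ (λ j → u j * v j) ]

  module Arr {n k : ℕ} (α : Fin n → Fin k → Carrier) where

    LinIndep : Subset n → Set
    LinIndep M = (c : Fin n → Carrier) → (∀ i → i ∉ M → c i ≡ 0#) →
                 (∀ j → Σ[ (λ i → c i * α i j) ] ≡ 0#) → ∀ i → c i ≡ 0#

    -- generic: any m ≤ k hyperplanes H_i = {x | α_i · x = 0} meet in
    -- codimension m, i.e. their normals are linearly independent
    Generic : Set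
    Generic = ∀ (M : Subset n) → ∣ M ∣ ℕ.≤ k → LinIndep M

    -- space of translates t ∈ ℝ^n ; x ∈ H_i + t_i α_i  iff  α_i·x = t_i (α_i·α_i)
    Translate : Set
    Translate = Fin n → Carrier

    OnTranslate : Translate → Fin n → (Fin k → Carrier) → Set
    OnTranslate t i x = α i · x ≡ t i * (α i · α i)

    D : Subset n → Translate → Set
    D L t = ∃ λ (x : Fin k → Carrier) → ∀ i → i Sub.∈ L → OnTranslate t i x

    D* : Subset n → Translate → Set
    D* S t = ∀ L → L Sub.⊆ S → ∣ L ∣ ≡ suc k → D L t

    Region : Set₁
    Region = Translate → Set

    _⊆R_ : Region → Region → Set
    X ⊆R Y = ∀ t → X t → Y t

    -- X ∈ L(B(n,k,A)): X is an intersection of hyperplanes D_L, |L| = k+1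
    InLattice : Region → Set
    InLattice X = Σ (List (Subset n)) λ F →
      All (λ L → ∣ L ∣ ≡ suc k) F × (∀ t → X t ⇔ All (λ L → D L t) F)

    IsComponent : Region → Subset n → Set
    IsComponent X S = suc k ℕ.≤ ∣ S ∣ × X ⊆R D* S ×
                      (∀ j → j ∉ S → ¬ (X ⊆R D* (S ∪ ⁅ j ⁆)))

    CanonicalPresentation : Region → List (Subset n) → Set
    CanonicalPresentation X Ss =
      Unique Ss × (∀ S → (S LM.∈ Ss) ⇔ IsComponent X S)

{-# OPTIONS --safe #-}
module Submission where

-- Every component S_i has at least k + 1 indices, so it contributes at least 1
-- to a_X = Σ (|S_i| - k).  Counting the incidences j ∈ S_i once by sets and once
-- by indices gives Σ |S_i| = Σ_j mult(j), which is at least n ℓ_X when the S_i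
-- cover [n]; and a_X ≥ Σ |S_i| - m k.  The geometry enters only through
-- |S_i| ≥ k + 1, which is part of being a component.

open import Defs
open import Data.Nat using (ℕ; _<_; _≤_; _*_; _∸_)
open import Data.Fin using (Fin)
open import Data.List using (List; length)
open import Data.Fin.Subset using (Subset; ⋃; ∣_∣)
open import Data.Product using (_×_)
open import Relation.Binary.PropositionalEquality using (_≡_)

open import Data.Nat using (zero; suc; _+_)
open import Data.Nat.Properties
open import Data.Fin using (zero; suc)
open import Data.Vec using (_∷_; []; tail)
open import Data.Bool using (true; false)
open import Data.List using (map; _∷_; [])
open import Data.List.Membership.Propositional using (_∈_)
open import Data.List.Membership.Propositional.Properties using (∈-map⁺; ∈-filter⁺; ∈-allFin)
open import Data.List.Relation.Unary.All using (All; _∷_; []; tabulate)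
open import Data.List.Relation.Unary.Any using (here; there)
import Data.Fin.Subset as Subset
open import Data.Fin.Subset.Properties using (_∈?_; ∣p∣≡n⇒p≡⊤; ∈⊤)
open import Data.Product using (_,_; proj₁)
open import Function.Bundles using (Equivalence)
open import Relation.Binary.PropositionalEquality using (refl; sym; cong; subst; module ≡-Reasoning)
open import Relation.Nullary using (yes; no)
open import Algebra.Properties.Monoid.Sum +-0-monoid using (sum-syntax; sum-cong-≗)
open import Algebra.Properties.CommutativeSemigroup +-commutativeSemigroup using (interchange; x∙yz≈y∙xz)

minList≤ : ∀ {x} (xs : List ℕ) → x ∈ xs → minList xs ≤ x
minList≤ (x ∷ [])     (here refl) = ≤-refl
minList≤ (x ∷ y ∷ xs) (here refl) = m⊓n≤m x _
minList≤ (x ∷ y ∷ xs) (there x∈)  = ≤-trans (m⊓n≤n x _) (minList≤ (y ∷ xs) x∈)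

n*c≤sum : ∀ n {c} (f : Fin n → ℕ) → (∀ i → c ≤ f i) → n * c ≤ ∑[ i < n ] f i
n*c≤sum zero    f c≤f = ≤-refl
n*c≤sum (suc n) f c≤f = +-mono-≤ (c≤f zero) (n*c≤sum n (λ i → f (suc i)) (λ i → c≤f (suc i)))

[m+n]∸[o+p]≤[m∸o]+[n∸p] : ∀ m n o p → (m + n) ∸ (o + p) ≤ (m ∸ o) + (n ∸ p)
[m+n]∸[o+p]≤[m∸o]+[n∸p] m n o p = m≤n+o⇒m∸n≤o (m + n) (o + p) (begin
  m + n                         ≤⟨ +-mono-≤ (m≤n+m∸n m o) (m≤n+m∸n n p) ⟩
  (o + (m ∸ o)) + (p + (n ∸ p)) ≡⟨ interchange o (m ∸ o) p (n ∸ p) ⟩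
  (o + p) + ((m ∸ o) + (n ∸ p)) ∎)
  where open ≤-Reasoning

module _ {n : ℕ} where

  totalSize : List (Subset n) → ℕ
  totalSize Ss = sumList (map ∣_∣ Ss)

  totalSize∸≤athanasiadis : ∀ k (Ss : List (Subset n)) →
    totalSize Ss ∸ length Ss * k ≤ athanasiadis k Ss
  totalSize∸≤athanasiadis k []       = ≤-refl
  totalSize∸≤athanasiadis k (S ∷ Ss) = ≤-trans
    ([m+n]∸[o+p]≤[m∸o]+[n∸p] ∣ S ∣ (totalSize Ss) k (length Ss * k))
    (+-monoʳ-≤ (∣ S ∣ ∸ k) (totalSize∸≤athanasiadis k Ss))

  length≤athanasiadis : ∀ {k} {Ss : List (Subset n)} →
    All (λ S → k < ∣ S ∣) Ss → length Ss ≤ athanasiadis k Ss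
  length≤athanasiadis []            = ≤-refl
  length≤athanasiadis (k<S ∷ k<Ss) = +-mono-≤ (m<n⇒0<n∸m k<S) (length≤athanasiadis k<Ss)

  ℓ-of≤multiplicity : ∀ (Ss : List (Subset n)) {j} → j Subset.∈ ⋃ Ss →
    ℓ-of Ss ≤ multiplicity Ss j
  ℓ-of≤multiplicity Ss j∈⋃ =
    minList≤ _ (∈-map⁺ (multiplicity Ss) (∈-filter⁺ (_∈? ⋃ Ss) (∈-allFin _) j∈⋃))

totalSize≡0 : (Ss : List (Subset 0)) → totalSize Ss ≡ 0
totalSize≡0 []        = refl
totalSize≡0 ([] ∷ Ss) = totalSize≡0 Ss

multiplicity-suc : ∀ {n} (Ss : List (Subset (suc n))) j →
  multiplicity Ss (suc j) ≡ multiplicity (map tail Ss) j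
multiplicity-suc []             j = refl
multiplicity-suc ((_ ∷ S) ∷ Ss) j with j ∈? S
... | yes _ = cong suc (multiplicity-suc Ss j)
... | no  _ = multiplicity-suc Ss j

totalSize-split : ∀ {n} (Ss : List (Subset (suc n))) →
  totalSize Ss ≡ multiplicity Ss zero + totalSize (map tail Ss)
totalSize-split-step : ∀ {n} (S : Subset n) (Ss : List (Subset (suc n))) →
  ∣ S ∣ + totalSize Ss ≡ multiplicity Ss zero + (∣ S ∣ + totalSize (map tail Ss))

totalSize-split []                 = refl
totalSize-split ((true ∷ S) ∷ Ss)  = cong suc (totalSize-split-step S Ss)
totalSize-split ((false ∷ S) ∷ Ss) = totalSize-split-step S Ss

totalSize-split-step S Ss = begin
  ∣ S ∣ + totalSize Ss                                     ≡⟨ cong (∣ S ∣ +_) (totalSize-split Ss) ⟩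
  ∣ S ∣ + (multiplicity Ss zero + totalSize (map tail Ss)) ≡⟨ x∙yz≈y∙xz ∣ S ∣ (multiplicity Ss zero) _ ⟩
  multiplicity Ss zero + (∣ S ∣ + totalSize (map tail Ss)) ∎
  where open ≡-Reasoning

sum-multiplicity≡totalSize : ∀ n (Ss : List (Subset n)) →
  ∑[ j < n ] multiplicity Ss j ≡ totalSize Ss
sum-multiplicity≡totalSize zero    Ss = sym (totalSize≡0 Ss)
sum-multiplicity≡totalSize (suc n) Ss = begin
  multiplicity Ss zero + ∑[ j < n ] multiplicity Ss (suc j)
    ≡⟨ cong (multiplicity Ss zero +_) (sum-cong-≗ (multiplicity-suc Ss)) ⟩
  multiplicity Ss zero + ∑[ j < n ] multiplicity (map tail Ss) j
    ≡⟨ cong (multiplicity Ss zero +_) (sum-multiplicity≡totalSize n (map tail Ss)) ⟩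
  multiplicity Ss zero + totalSize (map tail Ss)
    ≡⟨ sym (totalSize-split Ss) ⟩
  totalSize Ss ∎
  where open ≡-Reasoning

n*ℓ-of≤totalSize : ∀ {n} (Ss : List (Subset n)) → ∣ ⋃ Ss ∣ ≡ n → n * ℓ-of Ss ≤ totalSize Ss
n*ℓ-of≤totalSize {n} Ss covers = begin
  n * ℓ-of Ss                  ≤⟨ n*c≤sum n (multiplicity Ss) (λ j → ℓ-of≤multiplicity Ss (j∈⋃ j)) ⟩
  ∑[ j < n ] multiplicity Ss j ≡⟨ sum-multiplicity≡totalSize n Ss ⟩
  totalSize Ss                 ∎
  where
    open ≤-Reasoning
    j∈⋃ : ∀ j → j Subset.∈ ⋃ Ss
    j∈⋃ j = subst (j Subset.∈_) (sym (∣p∣≡n⇒p≡⊤ covers)) ∈⊤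

proposition4p5 : (R : Reals) (n k : ℕ) → k < n →
    (α : Fin n → Fin k → Reals.Carrier R) → Geometry.Arr.Generic R α →
    (X : Geometry.Arr.Region R α) → Geometry.Arr.InLattice R α X →
    (Ss : List (Subset n)) → Geometry.Arr.CanonicalPresentation R α X Ss →
    ∣ ⋃ Ss ∣ ≡ n →
    length Ss ≤ athanasiadis k Ss × n * ℓ-of Ss ∸ length Ss * k ≤ athanasiadis k Ss
proposition4p5 R n k _ α _ X _ Ss (_ , isComponent⇔) covers =
  length≤athanasiadis (tabulate (λ S∈Ss → proj₁ (Equivalence.to (isComponent⇔ _) S∈Ss))) ,
  (begin
    n * ℓ-of Ss ∸ length Ss * k  ≤⟨ ∸-monoˡ-≤ (length Ss * k) (n*ℓ-of≤totalSize Ss covers) ⟩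
    totalSize Ss ∸ length Ss * k ≤⟨ totalSize∸≤athanasiadis k Ss ⟩
    athanasiadis k Ss            ∎)
  where open ≤-Reasoning
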